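{- Let $p\ge1$, $r_1\le\cdots\le r_p$ nonnegative integers, $\mathbf{r}_p=(r_1,\ldots,r_p)$, and define $\widetilde{B}_n(z;\mathbf{r}_p)=\sum_{k=0}^{n}{n+|\mathbf{r}_p|\brace k+|\mathbf{r}_p|}_{\mathbf{r}_p}z^k$. Then, for every integer $k\ge0$, $$\sum_{n\ge k}{n+|\mathbf{r}_p|\brace k+|\mathbf{r}_p|}_{\mathbf{r}_p}t^n=t^{k+|\mathbf{r}_{p-1}|}\left(\tfrac1t\right)^{\underline{r_1}}\cdots\left(\tfrac1t\right)^{\underline{r_{p-1}}}\prod_{j=0}^{k+|\mathbf{r}_{p-1}|}\big(1-(r_p+j)t\big)^{ -1},$$ and $$\sum_{n\ge0}\widetilde{B}_n(z;\mathbf{r}_p)t^n=\left(\tfrac1t\right)^{\underline{r_1}}\cdots\left(\tfrac1t\right)^{\underline{r_{p-1}}}\sum_{k\ge|\mathbf{r}_{p-1}|}\frac{z^{k-|\mathbf{r}_{p-1}|}t^k}{\prod_{j=0}^{k}\big(1-(r_p+j)t\big)}.$$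
   Context: $|\mathbf{r}_p|=r_1+\cdots+r_p$, $|\mathbf{r}_{p-1}|=r_1+\cdots+r_{p-1}$; $x^{\underline{r}}=x(x-1)\cdots(x-r+1)$ (falling factorial, $x^{\underline 0}=1$). With $R_1=\{1,\ldots,r_1\}$, $R_2=\{r_1+1,\ldots,r_1+r_2\}$, ..., $R_p$ the next $r_p$ integers, ${N\brace k}_{\mathbf{r}_p}$ is the number of partitions of $\{1,\ldots,N\}$ into $k$ nonempty blocks such that for each $i$ the elements of $R_i$ lie in distinct blocks. -}

module Defs where

open import Data.Nat as ℕ using (ℕ; zero; suc; _≤ᵇ_; _<ᵇ_; _≡ᵇ_)
open import Data.Integer as ℤ using (ℤ; +_)
open import Data.Bool using (Bool; true; false; if_then_else_; _∧_; not)
open import Data.List as List using (List; []; _∷_)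
open import Data.Vec as Vec using (Vec)
open import Data.Fin using (Fin; toℕ)
open import Data.Nat.ListAction using () renaming (sum to sumℕ)
open import Relation.Binary.PropositionalEquality using (_≡_)

-- A partition of {1..N} into k nonempty blocks is encoded canonically by
-- its labelling  w : Vec (Fin k) N  (position i-1 holds the block label of
-- element i), where blocks are numbered 0,1,...,k-1 in increasing order
-- of their smallest element (restricted growth string) and every label is
-- used.  This is a bijection with set partitions into exactly k blocks.

allV : (k N : ℕ) → List (Vec (Fin k) N)
allV k zero    = Vec.[] ∷ []
allV k (suc N) = List.concatMap (λ x → List.map (x Vec.∷_) (allV k N)) (List.allFin k)

-- canonical labelling: m = number of blocks opened so far; a new block
-- must receive label m; at the end exactly k blocks must be opened.
canon : ℕ → List ℕ → ℕ → Bool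
canon m []       k = m ≡ᵇ k
canon m (x ∷ xs) k =
  if x <ᵇ m then canon m xs k
  else (if x ≡ᵇ m then canon (suc m) xs k else false)

elemᵇ : ℕ → List ℕ → Bool
elemᵇ x []       = false
elemᵇ x (y ∷ ys) = if x ≡ᵇ y then true else elemᵇ x ys

allDistinct : List ℕ → Bool
allDistinct []       = true
allDistinct (x ∷ xs) = not (elemᵇ x xs) ∧ allDistinct xs

-- R_1 = first r_1 positions, R_2 = next r_2 positions, ...; the elements of
-- each R_i must lie in distinct blocks (= have distinct labels)
distinctR : List ℕ → List ℕ → Bool
distinctR w []       = true
distinctR w (r ∷ rs) = allDistinct (List.take r w) ∧ distinctR (List.drop r w) rs

countTrue : {A : Set} → (A → Bool) → List A → ℕ
countTrue P []       = 0
countTrue P (x ∷ xs) = (if P x then 1 else 0) ℕ.+ countTrue P xs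

StirR : ℕ → ℕ → List ℕ → ℕ
StirR N k r = countTrue valid (allV k N)
  where
  valid : Vec (Fin k) N → Bool
  valid v = let w = Vec.toList (Vec.map toℕ v) in canon 0 w k ∧ distinctR w r

∣_∣ : List ℕ → ℕ
∣ r ∣ = sumℕ r

PS1 : Set
PS1 = ℕ → ℤ

sumTo : ℕ → (ℕ → ℤ) → ℤ
sumTo zero    h = h 0
sumTo (suc n) h = sumTo n h ℤ.+ h (suc n)

_-₁_ : PS1 → PS1 → PS1
(f -₁ g) n = f n ℤ.- g n

_*₁_ : PS1 → PS1 → PS1
(f *₁ g) n = sumTo n (λ i → f i ℤ.* g (n ℕ.∸ i))

const₁ : ℤ → PS1
const₁ c zero    = c
const₁ c (suc n) = + 0

one₁ : PS1
one₁ = const₁ (+ 1)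

tpow₁ : ℕ → PS1
tpow₁ m n = if n ≡ᵇ m then + 1 else + 0

oneMinus : ℤ → PS1
oneMinus c = one₁ -₁ (const₁ c *₁ tpow₁ 1)

prod₁ : (ℕ → PS1) → ℕ → PS1
prod₁ F zero    = F 0
prod₁ F (suc K) = prod₁ F K *₁ F (suc K)

-- multiplicative inverse of a power series f with f 0 = 1:
-- g 0 = 1,  g (n+1) = - Σ_{i=0}^{n} f (i+1) * g (n-i).
-- invList f n = [g n, g (n-1), ..., g 0]
invConv : PS1 → ℕ → List ℤ → ℤ
invConv f i []       = + 0
invConv f i (x ∷ xs) = f (suc i) ℤ.* x ℤ.+ invConv f (suc i) xs

invList : PS1 → ℕ → List ℤ
invList f zero    = + 1 ∷ []
invList f (suc n) = ℤ.- invConv f 0 (invList f n) ∷ invList f n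

headℤ : List ℤ → ℤ
headℤ []      = + 0
headℤ (x ∷ _) = x

inv₁ : PS1 → PS1
inv₁ f n = headℤ (invList f n)

-- Formal power series in z and t: f a n = coefficient of z^a t^n

PS2 : Set
PS2 = ℕ → ℕ → ℤ

_+₂_ : PS2 → PS2 → PS2
(f +₂ g) a n = f a n ℤ.+ g a n

_*₂_ : PS2 → PS2 → PS2
(f *₂ g) a n = sumTo a (λ i → sumTo n (λ j → f i j ℤ.* g (a ℕ.∸ i) (n ℕ.∸ j)))

neg₂ : PS2 → PS2
neg₂ f a n = ℤ.- f a n

emb : PS1 → PS2
emb f zero    n = f n
emb f (suc a) n = + 0

-- Σ_{a ≥ 0} z^a F_a(t)   (each F_a a series in t)
zSum : (ℕ → PS1) → PS2
zSum F a n = F a n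

shiftT : ℕ → PS2 → PS2
shiftT m f a n = if m ≤ᵇ n then f a (n ℕ.∸ m) else + 0

-- Formal Laurent series in t (over ℤ[[z]]):  laurent m f  represents t^(-m) f

record Laurent : Set where
  constructor laurent
  field
    sh  : ℕ
    ser : PS2
open Laurent public

infix 4 _≈L_
_≈L_ : Laurent → Laurent → Set
x ≈L y = ∀ a n → shiftT (sh y) (ser x) a n ≡ shiftT (sh x) (ser y) a n

_+L_ : Laurent → Laurent → Laurent
x +L y = laurent (sh x ℕ.+ sh y) (shiftT (sh y) (ser x) +₂ shiftT (sh x) (ser y))

_*L_ : Laurent → Laurent → Laurent
x *L y = laurent (sh x ℕ.+ sh y) (ser x *₂ ser y)

negL : Laurent → Laurent
negL x = laurent (sh x) (neg₂ (ser x))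

_-L_ : Laurent → Laurent → Laurent
x -L y = x +L negL y

ofPS : PS2 → Laurent
ofPS f = laurent 0 f

constL : ℤ → Laurent
constL c = ofPS (emb (const₁ c))

oneL : Laurent
oneL = constL (+ 1)

tInv : Laurent
tInv = laurent 1 (emb one₁)

tPowL : ℕ → Laurent
tPowL m = ofPS (emb (tpow₁ m))

fallingL : Laurent → ℕ → Laurent
fallingL x zero    = oneL
fallingL x (suc r) = fallingL x r *L (x -L constL (+ r))

prefactor : List ℕ → Laurent
prefactor = List.foldr (λ r acc → fallingL tInv r *L acc) oneL

colGF : List ℕ → ℕ → PS1
colGF r k n = if k ≤ᵇ n then + StirR (n ℕ.+ ∣ r ∣) (k ℕ.+ ∣ r ∣) r else + 0

Btilde : List ℕ → ℕ → ℕ → ℤ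
Btilde r n k = if k ≤ᵇ n then + StirR (n ℕ.+ ∣ r ∣) (k ℕ.+ ∣ r ∣) r else + 0

BGF : List ℕ → PS2
BGF r a n = Btilde r n a

module Submission where

-- The r-Stirling numbers satisfy a transfer recursion on restricted growth strings
-- (`completions`): the elements of R₁, …, R_p come first, each joining an open block not yet
-- used by its group or opening a new one, and the remaining elements are free.  Read as an
-- identity of power series, the recursion shows by induction over the groups that the column
-- series times ∏_{i ≤ k+|r|} (1 − i t) equals t^k ∏_ℓ ∏_{j < r_ℓ} (1 − j t).  Since
-- (1/t)^{\underline r} = t^{−r} ∏_{j < r} (1 − j t), cancelling the factors 1 − j t with j < r_p
-- against the denominator gives both identities.

open import Defs
open import Data.Nat using (ℕ; suc; _≤_; _+_)
open import Data.Integer using (+_)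
open import Data.Fin as Fin using (Fin)
open import Data.Vec as Vec using (Vec; _∷ʳ_; lookup; toList)
open import Data.Product using (_×_)

open import Level using (0ℓ)
open import Function using (_∘_; id)
open import Data.Nat as ℕ using (zero; _*_; _∸_; _<_; z≤n; s≤s; _<ᵇ_; _≡ᵇ_; _≤ᵇ_)
import Data.Nat.Properties as ℕₚ
open import Data.Nat.Tactic.RingSolver using () renaming (solve-∀ to ℕ-solve-∀)
open import Data.Integer as ℤ using (ℤ)
import Data.Integer.Properties as ℤₚ
open import Data.Integer.Tactic.RingSolver using (solve-∀)
open import Data.Bool using (Bool; true; false; if_then_else_; _∧_; not)
import Data.Bool.Properties as Boolₚ
open import Data.Fin using (toℕ)
open import Data.List as List using (List; []; _∷_; _++_; take; drop; length)
import Data.List.Properties as Listₚ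
open import Data.Nat.ListAction.Properties using (sum-++)
open import Data.Vec.Properties using (toList-∷ʳ)
open import Data.Product using (_,_)
open import Data.Sum using (_⊎_; inj₁; inj₂)
open import Relation.Nullary using (¬_; contradiction)
open import Relation.Nullary.Reflects using (Reflects; ofʸ; ofⁿ; fromEquivalence)
open import Relation.Binary.PropositionalEquality
import Relation.Binary.Reasoning.Setoid as SetoidReasoning
open import Algebra.Bundles using (CommutativeRing; CommutativeMonoid)
import Algebra.Properties.CommutativeSemigroup as CommSemigroupProperties
import Algebra.Solver.CommutativeMonoid as CommMonoidSolver

-- Formal power series in one variable

infix 4 _≐_
record _≐_ (f g : PS1) : Set where
  constructor coeffwise
  field coeff : ∀ n → f n ≡ g n
open _≐_ public

≐-refl : ∀ {f} → f ≐ f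
≐-refl .coeff _ = refl

≐-sym : ∀ {f g} → f ≐ g → g ≐ f
≐-sym p .coeff n = sym (coeff p n)

≐-trans : ∀ {f g h} → f ≐ g → g ≐ h → f ≐ h
≐-trans p q .coeff n = trans (coeff p n) (coeff q n)

infixl 6 _+₁_
_+₁_ : PS1 → PS1 → PS1
(f +₁ g) n = f n ℤ.+ g n

neg₁ : PS1 → PS1
neg₁ f n = ℤ.- f n

zero₁ : PS1
zero₁ _ = + 0

scale : ℤ → PS1 → PS1
scale c f n = c ℤ.* f n

tail₁ : PS1 → PS1
tail₁ f n = f (suc n)

sumTo-cong : ∀ n {h h′ : ℕ → ℤ} → (∀ i → i ≤ n → h i ≡ h′ i) → sumTo n h ≡ sumTo n h′
sumTo-cong zero    eq = eq 0 z≤n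
sumTo-cong (suc n) eq =
  cong₂ ℤ._+_ (sumTo-cong n (λ i i≤n → eq i (ℕₚ.m≤n⇒m≤1+n i≤n))) (eq (suc n) ℕₚ.≤-refl)

sumTo-suc : ∀ n h → sumTo (suc n) h ≡ h 0 ℤ.+ sumTo n (h ∘ suc)
sumTo-suc zero    h = refl
sumTo-suc (suc n) h = begin
  sumTo (suc n) h ℤ.+ h (suc (suc n))               ≡⟨ cong (ℤ._+ h (suc (suc n))) (sumTo-suc n h) ⟩
  (h 0 ℤ.+ sumTo n (h ∘ suc)) ℤ.+ h (suc (suc n))   ≡⟨ ℤₚ.+-assoc (h 0) _ _ ⟩
  h 0 ℤ.+ sumTo (suc n) (h ∘ suc)                   ∎
  where open ≡-Reasoning

sumTo-zero : ∀ n {h : ℕ → ℤ} → (∀ i → h i ≡ + 0) → sumTo n h ≡ + 0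
sumTo-zero zero    h≡0 = h≡0 0
sumTo-zero (suc n) h≡0 = cong₂ ℤ._+_ (sumTo-zero n h≡0) (h≡0 (suc n))

sumTo-+ : ∀ n h g → sumTo n (λ i → h i ℤ.+ g i) ≡ sumTo n h ℤ.+ sumTo n g
sumTo-+ zero    h g = refl
sumTo-+ (suc n) h g =
  trans (cong (ℤ._+ (h (suc n) ℤ.+ g (suc n))) (sumTo-+ n h g))
        (+-interchange (sumTo n h) (sumTo n g) (h (suc n)) (g (suc n)))
  where
  +-interchange : ∀ a b c d → (a ℤ.+ b) ℤ.+ (c ℤ.+ d) ≡ (a ℤ.+ c) ℤ.+ (b ℤ.+ d)
  +-interchange = solve-∀

*-sumTo : ∀ n c h → c ℤ.* sumTo n h ≡ sumTo n (λ i → c ℤ.* h i)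
*-sumTo zero    c h = refl
*-sumTo (suc n) c h = trans (ℤₚ.*-distribˡ-+ c (sumTo n h) (h (suc n)))
                            (cong (ℤ._+ (c ℤ.* h (suc n))) (*-sumTo n c h))

sumTo-reverse : ∀ n h → sumTo n h ≡ sumTo n (λ i → h (n ∸ i))
sumTo-reverse zero    h = refl
sumTo-reverse (suc n) h = begin
  sumTo n h ℤ.+ h (suc n)                      ≡⟨ ℤₚ.+-comm (sumTo n h) _ ⟩
  h (suc n) ℤ.+ sumTo n h                      ≡⟨ cong (ℤ._+_ (h (suc n))) (sumTo-reverse n h) ⟩
  h (suc n) ℤ.+ sumTo n (λ i → h (n ∸ i))      ≡⟨ sumTo-suc n (λ i → h (suc n ∸ i)) ⟨
  sumTo (suc n) (λ i → h (suc n ∸ i))          ∎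
  where open ≡-Reasoning

*₁-suc : ∀ f g n → (f *₁ g) (suc n) ≡ f 0 ℤ.* g (suc n) ℤ.+ (tail₁ f *₁ g) n
*₁-suc f g n = sumTo-suc n (λ i → f i ℤ.* g (suc n ∸ i))

*₁-cong : ∀ {f f′ g g′} → f ≐ f′ → g ≐ g′ → f *₁ g ≐ f′ *₁ g′
*₁-cong f≐f′ g≐g′ .coeff n =
  sumTo-cong n (λ i _ → cong₂ ℤ._*_ (coeff f≐f′ i) (coeff g≐g′ (n ∸ i)))

*₁-congˡ : ∀ h {g g′} → g ≐ g′ → h *₁ g ≐ h *₁ g′
*₁-congˡ h = *₁-cong (≐-refl {h})

*₁-congʳ : ∀ h {f f′} → f ≐ f′ → f *₁ h ≐ f′ *₁ h
*₁-congʳ h f≐f′ = *₁-cong f≐f′ (≐-refl {h})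

+₁-cong : ∀ {f f′ g g′} → f ≐ f′ → g ≐ g′ → f +₁ g ≐ f′ +₁ g′
+₁-cong f≐f′ g≐g′ .coeff n = cong₂ ℤ._+_ (coeff f≐f′ n) (coeff g≐g′ n)

*₁-zeroˡ : ∀ {f} g → f ≐ zero₁ → f *₁ g ≐ zero₁
*₁-zeroˡ g f≐0 .coeff n = sumTo-zero n (λ i → cong (ℤ._* g (n ∸ i)) (coeff f≐0 i))

*₁-distribʳ : ∀ f g h → (f +₁ g) *₁ h ≐ (f *₁ h) +₁ (g *₁ h)
*₁-distribʳ f g h .coeff n =
  trans (sumTo-cong n (λ i _ → ℤₚ.*-distribʳ-+ (h (n ∸ i)) (f i) (g i))) (sumTo-+ n _ _)

scale-*₁ : ∀ c f g → scale c f *₁ g ≐ scale c (f *₁ g)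
scale-*₁ c f g .coeff n = trans (sumTo-cong n (λ i _ → ℤₚ.*-assoc c (f i) _)) (sym (*-sumTo n c _))

tail₁-*₁ : ∀ f g → tail₁ (f *₁ g) ≐ scale (f 0) (tail₁ g) +₁ (tail₁ f *₁ g)
tail₁-*₁ f g .coeff = *₁-suc f g

*₁-assoc : ∀ f g h → (f *₁ g) *₁ h ≐ f *₁ (g *₁ h)
*₁-assoc f g h .coeff zero    = ℤₚ.*-assoc (f 0) (g 0) (h 0)
*₁-assoc f g h .coeff (suc n) = begin
  ((f *₁ g) *₁ h) (suc n)
    ≡⟨ *₁-suc (f *₁ g) h n ⟩
  (f 0 ℤ.* g 0) ℤ.* h (suc n) ℤ.+ (tail₁ (f *₁ g) *₁ h) n
    ≡⟨ cong (λ x → (f 0 ℤ.* g 0) ℤ.* h (suc n) ℤ.+ x) tail-assoc ⟩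
  (f 0 ℤ.* g 0) ℤ.* h (suc n) ℤ.+ (f 0 ℤ.* (tail₁ g *₁ h) n ℤ.+ (tail₁ f *₁ (g *₁ h)) n)
    ≡⟨ regroup (f 0) (g 0) (h (suc n)) ((tail₁ g *₁ h) n) ((tail₁ f *₁ (g *₁ h)) n) ⟩
  f 0 ℤ.* (g 0 ℤ.* h (suc n) ℤ.+ (tail₁ g *₁ h) n) ℤ.+ (tail₁ f *₁ (g *₁ h)) n
    ≡⟨ cong (λ x → f 0 ℤ.* x ℤ.+ (tail₁ f *₁ (g *₁ h)) n) (*₁-suc g h n) ⟨
  f 0 ℤ.* (g *₁ h) (suc n) ℤ.+ (tail₁ f *₁ (g *₁ h)) n
    ≡⟨ *₁-suc f (g *₁ h) n ⟨
  (f *₁ (g *₁ h)) (suc n) ∎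
  where
  open ≡-Reasoning
  tail-assoc : (tail₁ (f *₁ g) *₁ h) n ≡ f 0 ℤ.* (tail₁ g *₁ h) n ℤ.+ (tail₁ f *₁ (g *₁ h)) n
  tail-assoc = trans (coeff (*₁-congʳ h (tail₁-*₁ f g)) n)
             (trans (coeff (*₁-distribʳ (scale (f 0) (tail₁ g)) (tail₁ f *₁ g) h) n)
                    (cong₂ ℤ._+_ (coeff (scale-*₁ (f 0) (tail₁ g) h) n)
                                 (coeff (*₁-assoc (tail₁ f) g h) n)))
  regroup : ∀ a b c x z → (a ℤ.* b) ℤ.* c ℤ.+ (a ℤ.* x ℤ.+ z) ≡ a ℤ.* (b ℤ.* c ℤ.+ x) ℤ.+ z
  regroup = solve-∀

*₁-comm : ∀ f g → f *₁ g ≐ g *₁ f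
*₁-comm f g .coeff n = trans (sumTo-reverse n _) (sumTo-cong n (λ i i≤n →
  trans (ℤₚ.*-comm (f (n ∸ i)) _) (cong (λ j → g j ℤ.* f (n ∸ i)) (ℕₚ.m∸[m∸n]≡n i≤n))))

*₁-distribˡ : ∀ f g h → f *₁ (g +₁ h) ≐ (f *₁ g) +₁ (f *₁ h)
*₁-distribˡ f g h .coeff n = begin
  (f *₁ (g +₁ h)) n           ≡⟨ coeff (*₁-comm f (g +₁ h)) n ⟩
  ((g +₁ h) *₁ f) n           ≡⟨ coeff (*₁-distribʳ g h f) n ⟩
  (g *₁ f) n ℤ.+ (h *₁ f) n   ≡⟨ cong₂ ℤ._+_ (coeff (*₁-comm g f) n) (coeff (*₁-comm h f) n) ⟩
  (f *₁ g) n ℤ.+ (f *₁ h) n   ∎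
  where open ≡-Reasoning

const₁-*₁ : ∀ c f → const₁ c *₁ f ≐ scale c f
const₁-*₁ c f .coeff zero    = refl
const₁-*₁ c f .coeff (suc n) =
  trans (*₁-suc (const₁ c) f n)
        (trans (cong (ℤ._+_ (c ℤ.* f (suc n))) (coeff (*₁-zeroˡ f (coeffwise λ _ → refl)) n))
               (ℤₚ.+-identityʳ _))

*₁-identityˡ : ∀ f → one₁ *₁ f ≐ f
*₁-identityˡ f .coeff n = trans (coeff (const₁-*₁ (+ 1) f) n) (ℤₚ.*-identityˡ (f n))

*₁-identityʳ : ∀ f → f *₁ one₁ ≐ f
*₁-identityʳ f .coeff n = trans (coeff (*₁-comm f one₁) n) (coeff (*₁-identityˡ f) n)

powerSeriesRing : CommutativeRing 0ℓ 0ℓ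
powerSeriesRing = record
  { Carrier = PS1 ; _≈_ = _≐_ ; _+_ = _+₁_ ; _*_ = _*₁_ ; -_ = neg₁ ; 0# = zero₁ ; 1# = one₁
  ; isCommutativeRing = record
    { isRing = record
      { +-isAbelianGroup = record
        { isGroup = record
          { isMonoid = record
            { isSemigroup = record
              { isMagma = record
                { isEquivalence = record { refl = ≐-refl ; sym = ≐-sym ; trans = ≐-trans }
                ; ∙-cong = +₁-cong }
              ; assoc = λ f g h → coeffwise λ n → ℤₚ.+-assoc (f n) (g n) (h n) }
            ; identity = (λ f → coeffwise λ n → ℤₚ.+-identityˡ (f n))
                       , (λ f → coeffwise λ n → ℤₚ.+-identityʳ (f n)) }
          ; inverse = (λ f → coeffwise λ n → ℤₚ.+-inverseˡ (f n))
                    , (λ f → coeffwise λ n → ℤₚ.+-inverseʳ (f n))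
          ; ⁻¹-cong = λ p → coeffwise λ n → cong ℤ.-_ (coeff p n) }
        ; comm = λ f g → coeffwise λ n → ℤₚ.+-comm (f n) (g n) }
      ; *-cong = *₁-cong
      ; *-assoc = *₁-assoc
      ; *-identity = *₁-identityˡ , *₁-identityʳ
      ; distrib = *₁-distribˡ , λ h f g → *₁-distribʳ f g h }
    ; *-comm = *₁-comm } }

module PS = CommutativeRing powerSeriesRing
module ≐-Reasoning = SetoidReasoning PS.setoid
open CommSemigroupProperties PS.*-commutativeSemigroup using (interchange; x∙yz≈y∙xz)

const₁-cong : ∀ {a b} → a ≡ b → const₁ a ≐ const₁ b
const₁-cong a≡b .coeff n = cong (λ c → const₁ c n) a≡b

const₁-zero : const₁ (+ 0) ≐ zero₁
const₁-zero .coeff zero    = refl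
const₁-zero .coeff (suc n) = refl

*₁-regroup : ∀ d t te p x o →
  d *₁ ((t *₁ te) *₁ (p *₁ x)) +₁ te *₁ ((p *₁ o) *₁ x)
    ≐ te *₁ (p *₁ ((d *₁ t +₁ o) *₁ x))
*₁-regroup d t te p x o = begin
  d *₁ ((t *₁ te) *₁ (p *₁ x)) +₁ te *₁ ((p *₁ o) *₁ x)
    ≈⟨ +₁-cong (rearrange d t te p x) (*₁-congˡ te (*₁-assoc p o x)) ⟩
  te *₁ (p *₁ ((d *₁ t) *₁ x)) +₁ te *₁ (p *₁ (o *₁ x))
    ≈⟨ *₁-distribˡ te (p *₁ ((d *₁ t) *₁ x)) (p *₁ (o *₁ x)) ⟨
  te *₁ (p *₁ ((d *₁ t) *₁ x) +₁ p *₁ (o *₁ x))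
    ≈⟨ *₁-congˡ te (*₁-distribˡ p ((d *₁ t) *₁ x) (o *₁ x)) ⟨
  te *₁ (p *₁ ((d *₁ t) *₁ x +₁ o *₁ x))
    ≈⟨ *₁-congˡ te (*₁-congˡ p (*₁-distribʳ (d *₁ t) o x)) ⟨
  te *₁ (p *₁ ((d *₁ t +₁ o) *₁ x)) ∎
  where
  open ≐-Reasoning
  open CommMonoidSolver PS.*-commutativeMonoid using (solve; _⊜_; _⊕_)
  rearrange : ∀ d t te p x → d *₁ ((t *₁ te) *₁ (p *₁ x)) ≐ te *₁ (p *₁ ((d *₁ t) *₁ x))
  rearrange = solve 5 (λ d t te p x → d ⊕ ((t ⊕ te) ⊕ (p ⊕ x)) ⊜ te ⊕ (p ⊕ ((d ⊕ t) ⊕ x)))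
                      ≐-refl

tpow₁-zero : tpow₁ 0 ≐ one₁
tpow₁-zero .coeff zero    = refl
tpow₁-zero .coeff (suc n) = refl

tpow₁-*₁ : ∀ k f n → (tpow₁ k *₁ f) n ≡ (if k ≤ᵇ n then f (n ∸ k) else + 0)
tpow₁-*₁ zero    f n       = trans (coeff (*₁-congʳ f tpow₁-zero) n) (coeff (*₁-identityˡ f) n)
tpow₁-*₁ (suc k) f zero    = refl
tpow₁-*₁ (suc k) f (suc n) =
  trans (*₁-suc (tpow₁ (suc k)) f n)
        (trans (ℤₚ.+-identityˡ _)
               (trans (tpow₁-*₁ k f n) (cong (λ b → if b then f (n ∸ k) else + 0) (≤ᵇ-suc k))))
  where
  ≤ᵇ-suc : ∀ k → (k ≤ᵇ n) ≡ (suc k ≤ᵇ suc n)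
  ≤ᵇ-suc zero    = refl
  ≤ᵇ-suc (suc k) = refl

tpow₁-suc : ∀ e → tpow₁ (suc e) ≐ tpow₁ 1 *₁ tpow₁ e
tpow₁-suc e .coeff zero    = refl
tpow₁-suc e .coeff (suc n) = sym (tpow₁-*₁ 1 (tpow₁ e) (suc n))

tpow₁-+ : ∀ a b → tpow₁ (a + b) ≐ tpow₁ a *₁ tpow₁ b
tpow₁-+ zero    b = ≐-sym (≐-trans (*₁-congʳ (tpow₁ b) tpow₁-zero) (*₁-identityˡ (tpow₁ b)))
tpow₁-+ (suc a) b = begin
  tpow₁ (suc (a + b))                  ≈⟨ tpow₁-suc (a + b) ⟩
  tpow₁ 1 *₁ tpow₁ (a + b)             ≈⟨ *₁-congˡ (tpow₁ 1) (tpow₁-+ a b) ⟩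
  tpow₁ 1 *₁ (tpow₁ a *₁ tpow₁ b)      ≈⟨ *₁-assoc (tpow₁ 1) (tpow₁ a) (tpow₁ b) ⟨
  (tpow₁ 1 *₁ tpow₁ a) *₁ tpow₁ b      ≈⟨ *₁-congʳ (tpow₁ b) (tpow₁-suc a) ⟨
  tpow₁ (suc a) *₁ tpow₁ b             ∎
  where open ≐-Reasoning

invConv-sumTo : ∀ f n i →
  invConv f i (invList f n) ≡ sumTo n (λ l → f (suc (l + i)) ℤ.* inv₁ f (n ∸ l))
invConv-sumTo f zero    i = ℤₚ.+-identityʳ _
invConv-sumTo f (suc n) i = begin
  f (suc i) ℤ.* inv₁ f (suc n) ℤ.+ invConv f (suc i) (invList f n)
    ≡⟨ cong (ℤ._+_ (f (suc i) ℤ.* inv₁ f (suc n))) (invConv-sumTo f n (suc i)) ⟩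
  f (suc i) ℤ.* inv₁ f (suc n) ℤ.+ sumTo n (λ l → f (suc (l + suc i)) ℤ.* inv₁ f (n ∸ l))
    ≡⟨ cong (ℤ._+_ (f (suc i) ℤ.* inv₁ f (suc n)))
            (sumTo-cong n (λ l _ → cong (λ x → f (suc x) ℤ.* inv₁ f (n ∸ l)) (ℕₚ.+-suc l i))) ⟩
  f (suc i) ℤ.* inv₁ f (suc n) ℤ.+ sumTo n (λ l → f (suc (suc l + i)) ℤ.* inv₁ f (n ∸ l))
    ≡⟨ sumTo-suc n (λ l → f (suc (l + i)) ℤ.* inv₁ f (suc n ∸ l)) ⟨
  sumTo (suc n) (λ l → f (suc (l + i)) ℤ.* inv₁ f (suc n ∸ l)) ∎
  where open ≡-Reasoning

*₁-inv₁ : ∀ f → f 0 ≡ + 1 → f *₁ inv₁ f ≐ one₁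
*₁-inv₁ f f0≡1 .coeff zero    = cong (ℤ._* + 1) f0≡1
*₁-inv₁ f f0≡1 .coeff (suc n) = begin
  (f *₁ inv₁ f) (suc n)                              ≡⟨ *₁-suc f (inv₁ f) n ⟩
  f 0 ℤ.* inv₁ f (suc n) ℤ.+ tail                    ≡⟨ cong (λ x → x ℤ.* inv₁ f (suc n) ℤ.+ tail) f0≡1 ⟩
  + 1 ℤ.* (ℤ.- invConv f 0 (invList f n)) ℤ.+ tail
    ≡⟨ cong (λ x → + 1 ℤ.* (ℤ.- x) ℤ.+ tail) convolution ⟩
  + 1 ℤ.* (ℤ.- tail) ℤ.+ tail                        ≡⟨ cancel tail ⟩
  + 0                                                ∎
  where
  open ≡-Reasoning
  tail = (tail₁ f *₁ inv₁ f) n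
  convolution : invConv f 0 (invList f n) ≡ tail
  convolution = trans (invConv-sumTo f n 0)
    (sumTo-cong n (λ l _ → cong (λ x → f (suc x) ℤ.* inv₁ f (n ∸ l)) (ℕₚ.+-identityʳ l)))
  cancel : ∀ x → + 1 ℤ.* (ℤ.- x) ℤ.+ x ≡ + 0
  cancel = solve-∀

inv₁-unique : ∀ f {g} → f 0 ≡ + 1 → f *₁ g ≐ one₁ → inv₁ f ≐ g
inv₁-unique f {g} f0≡1 fg≐1 = begin
  inv₁ f                  ≈⟨ *₁-identityʳ (inv₁ f) ⟨
  inv₁ f *₁ one₁          ≈⟨ *₁-congˡ (inv₁ f) fg≐1 ⟨
  inv₁ f *₁ (f *₁ g)      ≈⟨ *₁-assoc (inv₁ f) f g ⟨
  (inv₁ f *₁ f) *₁ g      ≈⟨ *₁-congʳ g (≐-trans (*₁-comm (inv₁ f) f) (*₁-inv₁ f f0≡1)) ⟩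
  one₁ *₁ g               ≈⟨ *₁-identityˡ g ⟩
  g                       ∎
  where open ≐-Reasoning

inv₁-cong : ∀ {f g} → f 0 ≡ + 1 → f ≐ g → inv₁ f ≐ inv₁ g
inv₁-cong {f} {g} f0≡1 f≐g =
  inv₁-unique f f0≡1 (≐-trans (*₁-congʳ (inv₁ g) f≐g)
                              (*₁-inv₁ g (trans (sym (coeff f≐g 0)) f0≡1)))

*₁-inv₁-*₁ : ∀ f g → f 0 ≡ + 1 → g 0 ≡ + 1 → f *₁ inv₁ (f *₁ g) ≐ inv₁ g
*₁-inv₁-*₁ f g f0≡1 g0≡1 = ≐-sym (inv₁-unique g g0≡1 (begin
  g *₁ (f *₁ inv₁ (f *₁ g))   ≈⟨ *₁-assoc g f (inv₁ (f *₁ g)) ⟨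
  (g *₁ f) *₁ inv₁ (f *₁ g)   ≈⟨ *₁-congʳ (inv₁ (f *₁ g)) (*₁-comm g f) ⟩
  (f *₁ g) *₁ inv₁ (f *₁ g)   ≈⟨ *₁-inv₁ (f *₁ g) (cong₂ ℤ._*_ f0≡1 g0≡1) ⟩
  one₁                        ∎))
  where open ≐-Reasoning

prod₁-0 : ∀ F → (∀ j → F j 0 ≡ + 1) → ∀ K → prod₁ F K 0 ≡ + 1
prod₁-0 F F0≡1 zero    = F0≡1 0
prod₁-0 F F0≡1 (suc K) = cong₂ ℤ._*_ (prod₁-0 F F0≡1 K) (F0≡1 (suc K))

inv₁-prod₁ : ∀ F → (∀ j → F j 0 ≡ + 1) → ∀ K → inv₁ (prod₁ F K) ≐ prod₁ (inv₁ ∘ F) K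
inv₁-prod₁ F F0≡1 zero    = ≐-refl
inv₁-prod₁ F F0≡1 (suc K) = inv₁-unique (P *₁ F′) (prod₁-0 F F0≡1 (suc K)) (begin
  (P *₁ F′) *₁ (prod₁ (inv₁ ∘ F) K *₁ inv₁ F′)
    ≈⟨ *₁-congˡ (P *₁ F′) (*₁-congʳ (inv₁ F′) (inv₁-prod₁ F F0≡1 K)) ⟨
  (P *₁ F′) *₁ (inv₁ P *₁ inv₁ F′)
    ≈⟨ interchange P F′ (inv₁ P) (inv₁ F′) ⟩
  (P *₁ inv₁ P) *₁ (F′ *₁ inv₁ F′)
    ≈⟨ *₁-cong (*₁-inv₁ P (prod₁-0 F F0≡1 K)) (*₁-inv₁ F′ (F0≡1 (suc K))) ⟩
  one₁ *₁ one₁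
    ≈⟨ *₁-identityˡ one₁ ⟩
  one₁ ∎)
  where
  open ≐-Reasoning
  P = prod₁ F K
  F′ = F (suc K)

oneMinus-coeff : ∀ c n → oneMinus c n ≡ one₁ n ℤ.- c ℤ.* tpow₁ 1 n
oneMinus-coeff c n = cong (λ x → one₁ n ℤ.- x) (coeff (const₁-*₁ c (tpow₁ 1)) n)

oneMinus-0 : ∀ c → oneMinus c 0 ≡ + 1
oneMinus-0 c = trans (oneMinus-coeff c 0) (lemma c)
  where
  lemma : ∀ c → + 1 ℤ.- c ℤ.* + 0 ≡ + 1
  lemma = solve-∀

tail₁-oneMinus : ∀ c → tail₁ (oneMinus c) ≐ const₁ (ℤ.- c)
tail₁-oneMinus c .coeff zero    = trans (oneMinus-coeff c 1) (lemma c)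
  where
  lemma : ∀ c → + 0 ℤ.- c ℤ.* + 1 ≡ ℤ.- c
  lemma = solve-∀
tail₁-oneMinus c .coeff (suc n) = trans (oneMinus-coeff c (suc (suc n))) (lemma c)
  where
  lemma : ∀ c → + 0 ℤ.- c ℤ.* + 0 ≡ + 0
  lemma = solve-∀

oneMinus-*₁-suc : ∀ c f n → (oneMinus c *₁ f) (suc n) ≡ f (suc n) ℤ.- c ℤ.* f n
oneMinus-*₁-suc c f n = begin
  (oneMinus c *₁ f) (suc n)
    ≡⟨ *₁-suc (oneMinus c) f n ⟩
  oneMinus c 0 ℤ.* f (suc n) ℤ.+ (tail₁ (oneMinus c) *₁ f) n
    ≡⟨ cong₂ (λ a b → a ℤ.* f (suc n) ℤ.+ b) (oneMinus-0 c)
             (coeff (≐-trans (*₁-congʳ f (tail₁-oneMinus c)) (const₁-*₁ (ℤ.- c) f)) n) ⟩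
  + 1 ℤ.* f (suc n) ℤ.+ ℤ.- c ℤ.* f n
    ≡⟨ lemma (f (suc n)) c (f n) ⟩
  f (suc n) ℤ.- c ℤ.* f n ∎
  where
  open ≡-Reasoning
  lemma : ∀ a c b → + 1 ℤ.* a ℤ.+ ℤ.- c ℤ.* b ≡ a ℤ.- c ℤ.* b
  lemma = solve-∀

recurrence⇒*₁-oneMinus : ∀ c f g → (∀ n → f (suc n) ≡ c ℤ.* f n ℤ.+ g n) →
                         f *₁ oneMinus c ≐ const₁ (f 0) +₁ tpow₁ 1 *₁ g
recurrence⇒*₁-oneMinus c f g rec .coeff zero    =
  trans (cong (f 0 ℤ.*_) (oneMinus-0 c)) (lemma (f 0) (g 0))
  where
  lemma : ∀ a b → a ℤ.* + 1 ≡ a ℤ.+ + 0 ℤ.* b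
  lemma = solve-∀
recurrence⇒*₁-oneMinus c f g rec .coeff (suc n) = begin
  (f *₁ oneMinus c) (suc n)          ≡⟨ coeff (*₁-comm f (oneMinus c)) (suc n) ⟩
  (oneMinus c *₁ f) (suc n)          ≡⟨ oneMinus-*₁-suc c f n ⟩
  f (suc n) ℤ.- c ℤ.* f n            ≡⟨ cong (ℤ._- c ℤ.* f n) (rec n) ⟩
  c ℤ.* f n ℤ.+ g n ℤ.- c ℤ.* f n    ≡⟨ lemma c (f n) (g n) ⟩
  + 0 ℤ.+ g n                        ≡⟨ cong (ℤ._+_ (+ 0)) (tpow₁-*₁ 1 g (suc n)) ⟨
  + 0 ℤ.+ (tpow₁ 1 *₁ g) (suc n)     ∎
  where
  open ≡-Reasoning
  lemma : ∀ c a b → c ℤ.* a ℤ.+ b ℤ.- c ℤ.* a ≡ + 0 ℤ.+ b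
  lemma = solve-∀

oneMinus-split : ∀ {j m} → j ≤ m →
                 const₁ (+ (m ∸ j)) *₁ tpow₁ 1 +₁ oneMinus (+ m) ≐ oneMinus (+ j)
oneMinus-split {j} {m} j≤m .coeff n = begin
  (const₁ (+ (m ∸ j)) *₁ tpow₁ 1) n ℤ.+ oneMinus (+ m) n
    ≡⟨ cong₂ ℤ._+_ (coeff (const₁-*₁ (+ (m ∸ j)) (tpow₁ 1)) n) (oneMinus-coeff (+ m) n) ⟩
  + (m ∸ j) ℤ.* tpow₁ 1 n ℤ.+ (one₁ n ℤ.- + m ℤ.* tpow₁ 1 n)
    ≡⟨ cong (λ x → + (m ∸ j) ℤ.* tpow₁ 1 n ℤ.+ (one₁ n ℤ.- x ℤ.* tpow₁ 1 n)) m≡[m∸j]+j ⟩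
  + (m ∸ j) ℤ.* tpow₁ 1 n ℤ.+ (one₁ n ℤ.- (+ (m ∸ j) ℤ.+ + j) ℤ.* tpow₁ 1 n)
    ≡⟨ lemma (+ (m ∸ j)) (+ j) (one₁ n) (tpow₁ 1 n) ⟩
  one₁ n ℤ.- + j ℤ.* tpow₁ 1 n
    ≡⟨ oneMinus-coeff (+ j) n ⟨
  oneMinus (+ j) n ∎
  where
  open ≡-Reasoning
  m≡[m∸j]+j : + m ≡ + (m ∸ j) ℤ.+ + j
  m≡[m∸j]+j = cong +_ (sym (ℕₚ.m∸n+n≡m j≤m))
  lemma : ∀ d j o x → d ℤ.* x ℤ.+ (o ℤ.- (d ℤ.+ j) ℤ.* x) ≡ o ℤ.- j ℤ.* x
  lemma = solve-∀

oneMinusRange : ℕ → ℕ → PS1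
oneMinusRange j zero    = one₁
oneMinusRange j (suc c) = oneMinus (+ j) *₁ oneMinusRange (suc j) c

oneMinusRange-0 : ∀ j c → oneMinusRange j c 0 ≡ + 1
oneMinusRange-0 j zero    = refl
oneMinusRange-0 j (suc c) = cong₂ ℤ._*_ (oneMinus-0 (+ j)) (oneMinusRange-0 (suc j) c)

oneMinusRange-+ : ∀ j a b → oneMinusRange j (a + b) ≐ oneMinusRange j a *₁ oneMinusRange (j + a) b
oneMinusRange-+ j zero    b =
  ≐-trans (PS.reflexive (cong (λ i → oneMinusRange i b) (sym (ℕₚ.+-identityʳ j))))
          (≐-sym (*₁-identityˡ (oneMinusRange (j + 0) b)))
oneMinusRange-+ j (suc a) b = begin
  oneMinus (+ j) *₁ oneMinusRange (suc j) (a + b)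
    ≈⟨ *₁-congˡ (oneMinus (+ j)) (oneMinusRange-+ (suc j) a b) ⟩
  oneMinus (+ j) *₁ (oneMinusRange (suc j) a *₁ oneMinusRange (suc j + a) b)
    ≈⟨ *₁-assoc (oneMinus (+ j)) (oneMinusRange (suc j) a) (oneMinusRange (suc j + a) b) ⟨
  oneMinusRange j (suc a) *₁ oneMinusRange (suc j + a) b
    ≡⟨ cong (λ i → oneMinusRange j (suc a) *₁ oneMinusRange i b) (sym (ℕₚ.+-suc j a)) ⟩
  oneMinusRange j (suc a) *₁ oneMinusRange (j + suc a) b ∎
  where open ≐-Reasoning

oneMinusRange-suc : ∀ j c → oneMinusRange j (suc c) ≐ oneMinusRange j c *₁ oneMinus (+ (j + c))
oneMinusRange-suc j c = begin
  oneMinusRange j (suc c)                               ≡⟨ cong (oneMinusRange j) (ℕₚ.+-comm 1 c) ⟩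
  oneMinusRange j (c + 1)                               ≈⟨ oneMinusRange-+ j c 1 ⟩
  oneMinusRange j c *₁ (oneMinus (+ (j + c)) *₁ one₁)
    ≈⟨ *₁-congˡ (oneMinusRange j c) (*₁-identityʳ (oneMinus (+ (j + c)))) ⟩
  oneMinusRange j c *₁ oneMinus (+ (j + c))             ∎
  where open ≐-Reasoning

prod₁-oneMinus : ∀ j K → prod₁ (λ i → oneMinus (+ (j + i))) K ≐ oneMinusRange j (suc K)
prod₁-oneMinus j zero    = begin
  oneMinus (+ (j + 0))                ≡⟨ cong (λ i → oneMinus (+ i)) (ℕₚ.+-identityʳ j) ⟩
  oneMinus (+ j)                      ≈⟨ *₁-identityʳ (oneMinus (+ j)) ⟨
  oneMinus (+ j) *₁ one₁              ∎
  where open ≐-Reasoning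
prod₁-oneMinus j (suc K) = ≐-trans (*₁-congʳ (oneMinus (+ (j + suc K))) (prod₁-oneMinus j K))
                                   (≐-sym (oneMinusRange-suc j (suc K)))

fallingProduct : List ℕ → PS1
fallingProduct []       = one₁
fallingProduct (r ∷ rs) = oneMinusRange 0 r *₁ fallingProduct rs

fallingProduct-∷ʳ : ∀ rs r → fallingProduct (rs ++ r ∷ []) ≐ fallingProduct rs *₁ oneMinusRange 0 r
fallingProduct-∷ʳ []       r =
  ≐-trans (*₁-identityʳ (oneMinusRange 0 r)) (≐-sym (*₁-identityˡ (oneMinusRange 0 r)))
fallingProduct-∷ʳ (s ∷ rs) r =
  ≐-trans (*₁-congˡ (oneMinusRange 0 s) (fallingProduct-∷ʳ rs r))
          (≐-sym (*₁-assoc (oneMinusRange 0 s) (fallingProduct rs) (oneMinusRange 0 r)))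

-- Counting labellings

sum< : ℕ → (ℕ → ℕ) → ℕ
sum< zero    h = 0
sum< (suc k) h = h 0 + sum< k (h ∘ suc)

sum<-cong : ∀ k {h h′} → (∀ x → x < k → h x ≡ h′ x) → sum< k h ≡ sum< k h′
sum<-cong zero    eq = refl
sum<-cong (suc k) eq = cong₂ _+_ (eq 0 (s≤s z≤n)) (sum<-cong k (λ x x<k → eq (suc x) (s≤s x<k)))

sum<-zero : ∀ k {h} → (∀ x → h x ≡ 0) → sum< k h ≡ 0
sum<-zero zero    h≡0 = refl
sum<-zero (suc k) h≡0 = cong₂ _+_ (h≡0 0) (sum<-zero k (h≡0 ∘ suc))

sum<-const : ∀ k a → sum< k (λ _ → a) ≡ k * a
sum<-const zero    a = refl
sum<-const (suc k) a = cong (_+_ a) (sum<-const k a)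

sum<-+ : ∀ k h g → sum< k (λ x → h x + g x) ≡ sum< k h + sum< k g
sum<-+ zero    h g = refl
sum<-+ (suc k) h g = trans (cong (_+_ (h 0 + g 0)) (sum<-+ k (h ∘ suc) (g ∘ suc)))
                           (ℕ+.interchange (h 0) (g 0) (sum< k (h ∘ suc)) (sum< k (g ∘ suc)))
  where module ℕ+ = CommSemigroupProperties ℕₚ.+-commutativeSemigroup

sum<-split : ∀ m d h → sum< (m + d) h ≡ sum< m h + sum< d (λ i → h (m + i))
sum<-split zero    d h = refl
sum<-split (suc m) d h =
  trans (cong (_+_ (h 0)) (sum<-split m d (h ∘ suc))) (sym (ℕₚ.+-assoc (h 0) _ _))

sum<-indicator : ∀ {u m} A → u < m → sum< m (λ x → if x ≡ᵇ u then A else 0) ≡ A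
sum<-indicator {zero}  {suc m} A _         = trans (cong (_+_ A) (sum<-zero m (λ _ → refl)))
                                                     (ℕₚ.+-identityʳ A)
sum<-indicator {suc u} {suc m} A (s≤s u<m) = sum<-indicator A u<m

sum<-step : ∀ {m k} h g B → m ≤ k →
            (∀ x → x < m → h x ≡ g x) → h m ≡ B → (∀ x → m < x → h x ≡ 0) →
            (m ≡ k → B ≡ 0) → sum< k h ≡ sum< m g + B
sum<-step {m} {k} h g B m≤k below atM above m≡k⇒B≡0 = begin
  sum< k h                                    ≡⟨ cong (λ n → sum< n h) (ℕₚ.m+[n∸m]≡n m≤k) ⟨
  sum< (m + (k ∸ m)) h                        ≡⟨ sum<-split m (k ∸ m) h ⟩
  sum< m h + sum< (k ∸ m) (λ i → h (m + i))   ≡⟨ cong₂ _+_ (sum<-cong m below) (fromM (k ∸ m) refl) ⟩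
  sum< m g + B                                ∎
  where
  open ≡-Reasoning
  fromM : ∀ d → k ∸ m ≡ d → sum< d (λ i → h (m + i)) ≡ B
  fromM zero    d≡0 = sym (m≡k⇒B≡0 (trans (sym (ℕₚ.+-identityʳ m))
                                            (trans (cong (_+_ m) (sym d≡0)) (ℕₚ.m+[n∸m]≡n m≤k))))
  fromM (suc d) _   = trans (cong₂ _+_ (trans (cong h (ℕₚ.+-identityʳ m)) atM)
                                       (sum<-zero d (λ i → above (m + suc i) (ℕₚ.m<m+n m (s≤s z≤n)))))
                           (ℕₚ.+-identityʳ B)

reflects-true : ∀ {P : Set} {b} → Reflects P b → P → b ≡ true
reflects-true (ofʸ _)  _ = refl
reflects-true (ofⁿ ¬p) p = contradiction p ¬p

reflects-false : ∀ {P : Set} {b} → Reflects P b → ¬ P → b ≡ false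
reflects-false (ofʸ p) ¬p = contradiction p ¬p
reflects-false (ofⁿ _) _  = refl

≡ᵇ-reflects-≡ : ∀ m n → Reflects (m ≡ n) (m ≡ᵇ n)
≡ᵇ-reflects-≡ m n = fromEquivalence (ℕₚ.≡ᵇ⇒≡ m n) (ℕₚ.≡⇒≡ᵇ m n)

≡ᵇ-sym : ∀ m n → (m ≡ᵇ n) ≡ (n ≡ᵇ m)
≡ᵇ-sym zero    zero    = refl
≡ᵇ-sym zero    (suc n) = refl
≡ᵇ-sym (suc m) zero    = refl
≡ᵇ-sym (suc m) (suc n) = ≡ᵇ-sym m n

canon-old : ∀ {x m} w k → x < m → canon m (x ∷ w) k ≡ canon m w k
canon-old {x} {m} w k x<m rewrite reflects-true (ℕₚ.<ᵇ-reflects-< x m) x<m = refl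

canon-new : ∀ m w k → canon m (m ∷ w) k ≡ canon (suc m) w k
canon-new m w k
  rewrite reflects-false (ℕₚ.<ᵇ-reflects-< m m) (ℕₚ.n≮n m)
        | reflects-true (≡ᵇ-reflects-≡ m m) refl = refl

canon-invalid : ∀ {x m} w k → m < x → canon m (x ∷ w) k ≡ false
canon-invalid {x} {m} w k m<x
  rewrite reflects-false (ℕₚ.<ᵇ-reflects-< x m) (ℕₚ.<⇒≯ m<x)
        | reflects-false (≡ᵇ-reflects-≡ x m) (ℕₚ.>⇒≢ m<x) = refl

canon-overfull : ∀ m w {k} → k < m → canon m w k ≡ false
canon-overfull m []      {k} k<m = reflects-false (≡ᵇ-reflects-≡ m k) (ℕₚ.>⇒≢ k<m)
canon-overfull m (x ∷ w) k<m with x <ᵇ m | x ≡ᵇ m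
... | true  | _     = canon-overfull m w k<m
... | false | true  = canon-overfull (suc m) w (ℕₚ.m≤n⇒m≤1+n k<m)
... | false | false = refl

distinctFrom : List ℕ → List ℕ → Bool
distinctFrom U []       = true
distinctFrom U (x ∷ xs) = not (elemᵇ x U) ∧ distinctFrom (x ∷ U) xs

noneIn : List ℕ → List ℕ → Bool
noneIn U []       = true
noneIn U (x ∷ xs) = not (elemᵇ x U) ∧ noneIn U xs

module ∧-Properties =
  CommSemigroupProperties (CommutativeMonoid.commutativeSemigroup Boolₚ.∧-commutativeMonoid)

noneIn-∷ : ∀ x U xs → noneIn (x ∷ U) xs ≡ not (elemᵇ x xs) ∧ noneIn U xs
noneIn-∷ x U []       = refl
noneIn-∷ x U (y ∷ ys) rewrite ≡ᵇ-sym y x with x ≡ᵇ y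
... | true  = refl
... | false = trans (cong (not (elemᵇ y U) ∧_) (noneIn-∷ x U ys))
                    (∧-Properties.x∙yz≈y∙xz (not (elemᵇ y U)) (not (elemᵇ x ys)) (noneIn U ys))

noneIn-[] : ∀ xs → noneIn [] xs ≡ true
noneIn-[] []       = refl
noneIn-[] (x ∷ xs) = noneIn-[] xs

distinctFrom-noneIn : ∀ U xs → distinctFrom U xs ≡ allDistinct xs ∧ noneIn U xs
distinctFrom-noneIn U []       = refl
distinctFrom-noneIn U (x ∷ xs) = begin
  not (elemᵇ x U) ∧ distinctFrom (x ∷ U) xs
    ≡⟨ cong (not (elemᵇ x U) ∧_) (trans (distinctFrom-noneIn (x ∷ U) xs)
                                        (cong (allDistinct xs ∧_) (noneIn-∷ x U xs))) ⟩
  not (elemᵇ x U) ∧ (allDistinct xs ∧ (not (elemᵇ x xs) ∧ noneIn U xs))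
    ≡⟨ shuffle (not (elemᵇ x U)) (allDistinct xs) (not (elemᵇ x xs)) (noneIn U xs) ⟩
  (not (elemᵇ x xs) ∧ allDistinct xs) ∧ (not (elemᵇ x U) ∧ noneIn U xs) ∎
  where
  open ≡-Reasoning
  shuffle : ∀ a b c d → a ∧ (b ∧ (c ∧ d)) ≡ (c ∧ b) ∧ (a ∧ d)
  shuffle false b c d = sym (Boolₚ.∧-zeroʳ (c ∧ b))
  shuffle true  b c d = ∧-Properties.x∙yz≈yx∙z b c d

distinctFrom-[] : ∀ xs → distinctFrom [] xs ≡ allDistinct xs
distinctFrom-[] xs = trans (distinctFrom-noneIn [] xs)
                           (trans (cong (allDistinct xs ∧_) (noneIn-[] xs)) (Boolₚ.∧-identityʳ _))

data DistinctBelow (m : ℕ) : List ℕ → Set where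
  []   : DistinctBelow m []
  cons : ∀ {u U} → u < m → elemᵇ u U ≡ false → DistinctBelow m U → DistinctBelow m (u ∷ U)

DistinctBelow-suc : ∀ {m U} → DistinctBelow m U → DistinctBelow (suc m) U
DistinctBelow-suc []                  = []
DistinctBelow-suc (cons u<m u∉U U<m) = cons (ℕₚ.m≤n⇒m≤1+n u<m) u∉U (DistinctBelow-suc U<m)

DistinctBelow-∉ : ∀ {m U} → DistinctBelow m U → elemᵇ m U ≡ false
DistinctBelow-∉ []                          = refl
DistinctBelow-∉ {m} (cons {u} u<m _ U<m)
  rewrite reflects-false (≡ᵇ-reflects-≡ m u) (ℕₚ.>⇒≢ u<m) = DistinctBelow-∉ U<m

sum<-∉ : ∀ {m U} A → DistinctBelow m U →
         sum< m (λ x → if elemᵇ x U then 0 else A) ≡ (m ∸ length U) * A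
sum<-∉ {m} {U} A U<m = begin
  notIn U                                   ≡⟨ ℕₚ.m+n∸n≡m (notIn U) (length U * A) ⟨
  notIn U + length U * A ∸ length U * A     ≡⟨ cong (_∸ length U * A) (complement U<m) ⟩
  m * A ∸ length U * A                      ≡⟨ ℕₚ.*-distribʳ-∸ A m (length U) ⟨
  (m ∸ length U) * A                        ∎
  where
  open ≡-Reasoning
  notIn : List ℕ → ℕ
  notIn U = sum< m (λ x → if elemᵇ x U then 0 else A)
  removeOne : ∀ {u U} → elemᵇ u U ≡ false → ∀ x →
              (if elemᵇ x U then 0 else A)
                ≡ (if elemᵇ x (u ∷ U) then 0 else A) + (if x ≡ᵇ u then A else 0)
  removeOne {u} {U} u∉U x with x ≡ᵇ u | ≡ᵇ-reflects-≡ x u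
  ... | true  | ofʸ refl = cong (λ b → if b then 0 else A) u∉U
  ... | false | _        = sym (ℕₚ.+-identityʳ _)
  complement : ∀ {U} → DistinctBelow m U → notIn U + length U * A ≡ m * A
  complement []                         = trans (ℕₚ.+-identityʳ _) (sum<-const m A)
  complement {u ∷ U} (cons u<m u∉U U<m) = begin
    notIn (u ∷ U) + (A + length U * A)    ≡⟨ ℕₚ.+-assoc (notIn (u ∷ U)) A _ ⟨
    notIn (u ∷ U) + A + length U * A      ≡⟨ cong (_+ length U * A) removeOne-sum ⟩
    notIn U + length U * A                ≡⟨ complement U<m ⟩
    m * A                                 ∎
    where
    removeOne-sum : notIn (u ∷ U) + A ≡ notIn U
    removeOne-sum = sym (trans (sum<-cong m (λ x _ → removeOne {U = U} u∉U x))
                        (trans (sum<-+ m _ _) (cong (_+_ (notIn (u ∷ U))) (sum<-indicator A u<m))))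

-- Number of ways to label N further elements when m blocks are open, the current group has
-- c elements still to come and has already used j distinct blocks, the groups gs follow, and
-- exactly k blocks must be open at the end.  The last clause is the phase after all groups.
completions : ℕ → ℕ → ℕ → ℕ → List ℕ → ℕ → ℕ
completions zero    m j c       gs       k = if m ≡ᵇ k then 1 else 0
completions (suc N) m j (suc c) gs       k =
  (m ∸ j) * completions N m (suc j) c gs k + completions N (suc m) (suc j) c gs k
completions (suc N) m j zero    (g ∷ gs) k = completions (suc N) m 0 g gs k
completions (suc N) m j zero    []       k =
  m * completions N m 0 0 [] k + completions N (suc m) 0 0 [] k

completions-overfull : ∀ N m j c gs {k} → k < m → completions N m j c gs k ≡ 0
completions-overfull zero    m j c gs {k} k<m =
  cong (λ b → if b then 1 else 0) (reflects-false (≡ᵇ-reflects-≡ m k) (ℕₚ.>⇒≢ k<m))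
completions-overfull (suc N) m j (suc c) gs k<m
  rewrite completions-overfull N m (suc j) c gs k<m
        | completions-overfull N (suc m) (suc j) c gs (ℕₚ.m≤n⇒m≤1+n k<m)
  = trans (ℕₚ.+-identityʳ _) (ℕₚ.*-zeroʳ (m ∸ j))
completions-overfull (suc N) m j zero (g ∷ gs) k<m = completions-overfull (suc N) m 0 g gs k<m
completions-overfull (suc N) m j zero [] k<m
  rewrite completions-overfull N m 0 0 [] k<m
        | completions-overfull N (suc m) 0 0 [] (ℕₚ.m≤n⇒m≤1+n k<m)
  = trans (ℕₚ.+-identityʳ _) (ℕₚ.*-zeroʳ m)

-- The condition on the remaining labels w in the state described by completions, where U
-- lists the blocks already used by the current group.
admissible : ℕ → List ℕ → ℕ → List ℕ → ℕ → List ℕ → Bool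
admissible m U c gs k w = canon m w k ∧ (distinctFrom U (take c w) ∧ distinctR (drop c w) gs)

distinctR-[] : ∀ gs → distinctR [] gs ≡ true
distinctR-[] []       = refl
distinctR-[] (g ∷ gs) rewrite Listₚ.take-[] {A = ℕ} g | Listₚ.drop-[] {A = ℕ} g = distinctR-[] gs

admissible-[] : ∀ m U c gs k → admissible m U c gs k [] ≡ (m ≡ᵇ k)
admissible-[] m U c gs k
  rewrite Listₚ.take-[] {A = ℕ} c | Listₚ.drop-[] {A = ℕ} c | distinctR-[] gs = Boolₚ.∧-identityʳ _

countWords : ℕ → ℕ → (List ℕ → Bool) → ℕ
countWords k zero    P = if P [] then 1 else 0
countWords k (suc N) P = sum< k (λ x → countWords k N (λ w → P (x ∷ w)))

countWords-cong : ∀ k N {P Q} → (∀ w → P w ≡ Q w) → countWords k N P ≡ countWords k N Q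
countWords-cong k zero    P≡Q = cong (λ b → if b then 1 else 0) (P≡Q [])
countWords-cong k (suc N) P≡Q = sum<-cong k (λ x _ → countWords-cong k N (λ w → P≡Q (x ∷ w)))

countWords-false : ∀ k N {P} → (∀ w → P w ≡ false) → countWords k N P ≡ 0
countWords-false k zero    P≡false = cong (λ b → if b then 1 else 0) (P≡false [])
countWords-false k (suc N) P≡false =
  sum<-zero k (λ x → countWords-false k N (λ w → P≡false (x ∷ w)))

admissible-overfull : ∀ m U c gs {k} w → k < m → admissible m U c gs k w ≡ false
admissible-overfull m U c gs w k<m =
  cong (_∧ (distinctFrom U (take c w) ∧ distinctR (drop c w) gs)) (canon-overfull m w k<m)

admissible-reused : ∀ m U c gs k x w → elemᵇ x U ≡ true →
                    admissible m U (suc c) gs k (x ∷ w) ≡ false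
admissible-reused m U c gs k x w x∈U =
  trans (cong (λ e → canon m (x ∷ w) k ∧ ((not e ∧ D) ∧ distinctR (drop c w) gs)) x∈U)
        (Boolₚ.∧-zeroʳ (canon m (x ∷ w) k))
  where D = distinctFrom (x ∷ U) (take c w)

admissible-old : ∀ m U c gs k x w → x < m → elemᵇ x U ≡ false →
                 admissible m U (suc c) gs k (x ∷ w) ≡ admissible m (x ∷ U) c gs k w
admissible-old m U c gs k x w x<m x∉U =
  cong₂ (λ b e → b ∧ ((not e ∧ distinctFrom (x ∷ U) (take c w)) ∧ distinctR (drop c w) gs))
        (canon-old w k x<m) x∉U

admissible-new : ∀ m U c gs k w → elemᵇ m U ≡ false →
                 admissible m U (suc c) gs k (m ∷ w) ≡ admissible (suc m) (m ∷ U) c gs k w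
admissible-new m U c gs k w m∉U =
  cong₂ (λ b e → b ∧ ((not e ∧ distinctFrom (m ∷ U) (take c w)) ∧ distinctR (drop c w) gs))
        (canon-new m w k) m∉U

admissible-invalid : ∀ m U c gs k x w → m < x → admissible m U c gs k (x ∷ w) ≡ false
admissible-invalid m U c gs k x w m<x =
  cong (_∧ (distinctFrom U (take c (x ∷ w)) ∧ distinctR (drop c (x ∷ w)) gs)) (canon-invalid w k m<x)

countWords-admissible : ∀ N m U c gs k → DistinctBelow m U →
                        countWords k N (admissible m U c gs k) ≡ completions N m (length U) c gs k

countWords-overfull : ∀ N m U c gs {k} → k < m →
                      countWords k N (admissible m U c gs k) ≡ completions N m (length U) c gs k
countWords-overfull N m U c gs k<m =
  trans (countWords-false _ N (λ w → admissible-overfull m U c gs w k<m))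
        (sym (completions-overfull N m (length U) c gs k<m))

-- Sorting the first label into an old block, a new block or an invalid label gives the
-- recursion of completions.
countWords-group : ∀ N m U c gs k → DistinctBelow m U → m ≤ k →
  countWords k (suc N) (admissible m U (suc c) gs k) ≡ completions (suc N) m (length U) (suc c) gs k
countWords-group N m U c gs k U<m m≤k =
  trans (sum<-step _ _ B m≤k old new invalid newAtEnd) (cong (_+ B) (sum<-∉ A U<m))
  where
  A = completions N m (suc (length U)) c gs k
  B = completions N (suc m) (suc (length U)) c gs k
  newAtEnd : m ≡ k → B ≡ 0
  newAtEnd refl = completions-overfull N (suc m) (suc (length U)) c gs (ℕₚ.n<1+n m)
  old : ∀ x → x < m →
        countWords k N (λ w → admissible m U (suc c) gs k (x ∷ w)) ≡ (if elemᵇ x U then 0 else A)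
  old x x<m = byMembership (elemᵇ x U) refl
    where
    byMembership : ∀ e → elemᵇ x U ≡ e →
                   countWords k N (λ w → admissible m U (suc c) gs k (x ∷ w)) ≡ (if e then 0 else A)
    byMembership true  x∈U = countWords-false k N (λ w → admissible-reused m U c gs k x w x∈U)
    byMembership false x∉U = trans (countWords-cong k N (λ w → admissible-old m U c gs k x w x<m x∉U))
                                   (countWords-admissible N m (x ∷ U) c gs k (cons x<m x∉U U<m))
  new : countWords k N (λ w → admissible m U (suc c) gs k (m ∷ w)) ≡ B
  new = trans (countWords-cong k N (λ w → admissible-new m U c gs k w (DistinctBelow-∉ U<m)))
              (countWords-admissible N (suc m) (m ∷ U) c gs k
                 (cons (ℕₚ.n<1+n m) (DistinctBelow-∉ U<m) (DistinctBelow-suc U<m)))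
  invalid : ∀ x → m < x → countWords k N (λ w → admissible m U (suc c) gs k (x ∷ w)) ≡ 0
  invalid x m<x = countWords-false k N (λ w → admissible-invalid m U (suc c) gs k x w m<x)

countWords-free : ∀ N m U k → m ≤ k →
  countWords k (suc N) (admissible m U 0 [] k) ≡ completions (suc N) m (length U) 0 [] k
countWords-free N m U k m≤k =
  trans (sum<-step _ (λ _ → A) B m≤k old new invalid newAtEnd) (cong (_+ B) (sum<-const m A))
  where
  A = completions N m 0 0 [] k
  B = completions N (suc m) 0 0 [] k
  newAtEnd : m ≡ k → B ≡ 0
  newAtEnd refl = completions-overfull N (suc m) 0 0 [] (ℕₚ.n<1+n m)
  old : ∀ x → x < m → countWords k N (λ w → admissible m U 0 [] k (x ∷ w)) ≡ A
  old x x<m = trans (countWords-cong k N (λ w → cong (_∧ true) (canon-old w k x<m)))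
                    (countWords-admissible N m [] 0 [] k [])
  new : countWords k N (λ w → admissible m U 0 [] k (m ∷ w)) ≡ B
  new = trans (countWords-cong k N (λ w → cong (_∧ true) (canon-new m w k)))
              (countWords-admissible N (suc m) [] 0 [] k [])
  invalid : ∀ x → m < x → countWords k N (λ w → admissible m U 0 [] k (x ∷ w)) ≡ 0
  invalid x m<x = countWords-false k N (λ w → admissible-invalid m U 0 [] k x w m<x)

countWords-admissible zero m U c gs k _ = cong (λ b → if b then 1 else 0) (admissible-[] m U c gs k)
countWords-admissible (suc N) m U (suc c) gs k U<m with ℕₚ.≤-<-connex m k
... | inj₁ m≤k = countWords-group N m U c gs k U<m m≤k
... | inj₂ k<m = countWords-overfull (suc N) m U (suc c) gs k<m
countWords-admissible (suc N) m U zero (g ∷ gs) k _ =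
  trans (countWords-cong k (suc N) (λ w →
          cong (λ b → canon m w k ∧ (b ∧ distinctR (drop g w) gs)) (sym (distinctFrom-[] (take g w)))))
        (countWords-admissible (suc N) m [] g gs k [])
countWords-admissible (suc N) m U zero [] k _ with ℕₚ.≤-<-connex m k
... | inj₁ m≤k = countWords-free N m U k m≤k
... | inj₂ k<m = countWords-overfull (suc N) m U 0 [] k<m

countTrue-++ : ∀ {A : Set} (P : A → Bool) xs ys →
               countTrue P (xs ++ ys) ≡ countTrue P xs + countTrue P ys
countTrue-++ P []       ys = refl
countTrue-++ P (x ∷ xs) ys = trans (cong (_+_ (if P x then 1 else 0)) (countTrue-++ P xs ys))
                                   (sym (ℕₚ.+-assoc (if P x then 1 else 0) _ _))

countTrue-map : ∀ {A B : Set} (P : B → Bool) (f : A → B) xs →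
                countTrue P (List.map f xs) ≡ countTrue (P ∘ f) xs
countTrue-map P f []       = refl
countTrue-map P f (x ∷ xs) = cong (_+_ (if P (f x) then 1 else 0)) (countTrue-map P f xs)

countTrue-concatMap-tabulate :
  ∀ {A B : Set} (P : A → Bool) k (f : Fin k → B) (F : B → List A) {h : ℕ → ℕ} →
  (∀ i → countTrue P (F (f i)) ≡ h (toℕ i)) →
  countTrue P (List.concatMap F (List.tabulate f)) ≡ sum< k h
countTrue-concatMap-tabulate P zero    f F eq = refl
countTrue-concatMap-tabulate P (suc k) f F eq =
  trans (countTrue-++ P (F (f Fin.zero)) _)
        (cong₂ _+_ (eq Fin.zero) (countTrue-concatMap-tabulate P k (f ∘ Fin.suc) F (eq ∘ Fin.suc)))

countTrue-allV : ∀ k N (P : List ℕ → Bool) →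
                 countTrue (λ v → P (toList (Vec.map toℕ v))) (allV k N) ≡ countWords k N P
countTrue-allV k zero    P = ℕₚ.+-identityʳ _
countTrue-allV k (suc N) P =
  countTrue-concatMap-tabulate _ k id (λ x → List.map (x Vec.∷_) (allV k N)) (λ i →
    trans (countTrue-map _ (i Vec.∷_) (allV k N)) (countTrue-allV k N (λ w → P (toℕ i ∷ w))))

StirR-completions : ∀ N k r → StirR N k r ≡ completions N 0 0 0 r k
StirR-completions N k r = trans (countTrue-allV k N (λ w → canon 0 w k ∧ distinctR w r))
                                (countWords-admissible N 0 [] 0 r k [])

-- Generating functions

-- The exponent of t counts only the elements after the remaining group elements.
completionSeries : ℕ → ℕ → ℕ → List ℕ → ℕ → PS1
completionSeries m j c gs K n = + completions (c + ∣ gs ∣ + n) m j c gs K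

completionSeries-suc : ∀ m j c gs K →
  completionSeries m j (suc c) gs K
    ≐ const₁ (+ (m ∸ j)) *₁ completionSeries m (suc j) c gs K
      +₁ completionSeries (suc m) (suc j) c gs K
completionSeries-suc m j c gs K .coeff n =
  trans (ℤₚ.pos-+ ((m ∸ j) * completions (c + ∣ gs ∣ + n) m (suc j) c gs K) _)
        (cong (ℤ._+ completionSeries (suc m) (suc j) c gs K n)
              (trans (ℤₚ.pos-* (m ∸ j) _) (sym (coeff (const₁-*₁ (+ (m ∸ j)) S) n))))
  where S = completionSeries m (suc j) c gs K

completionSeries-nextGroup : ∀ m j g gs K →
                             completionSeries m j 0 (g ∷ gs) K ≐ completionSeries m 0 g gs K
completionSeries-nextGroup m j g gs K .coeff n with g + ∣ gs ∣ + n
... | zero  = refl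
... | suc _ = refl

freeSeries : ℕ → ℕ → PS1
freeSeries m K = completionSeries m 0 0 [] K

completionSeries-free : ∀ m j K → completionSeries m j 0 [] K ≐ freeSeries m K
completionSeries-free m j K .coeff zero    = refl
completionSeries-free m j K .coeff (suc n) = refl

freeSeries-overfull : ∀ {m K} → K < m → freeSeries m K ≐ zero₁
freeSeries-overfull K<m .coeff n = cong +_ (completions-overfull n _ 0 0 [] K<m)

freeSeries-*₁-oneMinus : ∀ m K f →
  freeSeries m K *₁ (oneMinus (+ m) *₁ f)
    ≐ (const₁ (freeSeries m K 0) +₁ tpow₁ 1 *₁ freeSeries (suc m) K) *₁ f
freeSeries-*₁-oneMinus m K f =
  ≐-trans (≐-sym (*₁-assoc (freeSeries m K) (oneMinus (+ m)) f))
          (*₁-congʳ f (recurrence⇒*₁-oneMinus (+ m) (freeSeries m K) (freeSeries (suc m) K) recurrence))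
  where
  recurrence : ∀ n → freeSeries m K (suc n) ≡ + m ℤ.* freeSeries m K n ℤ.+ freeSeries (suc m) K n
  recurrence n = trans (ℤₚ.pos-+ (m * completions n m 0 0 [] K) _)
                       (cong (ℤ._+ freeSeries (suc m) K n) (ℤₚ.pos-* m _))

freeSeries-*₁-oneMinusRange : ∀ e m K → e + m ≡ K →
                              freeSeries m K *₁ oneMinusRange m (suc e) ≐ tpow₁ e
freeSeries-*₁-oneMinusRange zero m .m refl = begin
  freeSeries m m *₁ (oneMinus (+ m) *₁ one₁)
    ≈⟨ freeSeries-*₁-oneMinus m m one₁ ⟩
  (const₁ (freeSeries m m 0) +₁ tpow₁ 1 *₁ freeSeries (suc m) m) *₁ one₁
    ≈⟨ *₁-identityʳ _ ⟩
  const₁ (freeSeries m m 0) +₁ tpow₁ 1 *₁ freeSeries (suc m) m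
    ≈⟨ +₁-cong (const₁-cong initial) (*₁-congˡ (tpow₁ 1) (freeSeries-overfull (ℕₚ.n<1+n m))) ⟩
  one₁ +₁ tpow₁ 1 *₁ zero₁
    ≈⟨ ≐-trans (+₁-cong (≐-refl {one₁}) (PS.zeroʳ (tpow₁ 1))) (PS.+-identityʳ one₁) ⟩
  one₁
    ≈⟨ tpow₁-zero ⟨
  tpow₁ 0 ∎
  where
  open ≐-Reasoning
  initial : freeSeries m m 0 ≡ + 1
  initial = cong (λ b → + (if b then 1 else 0)) (reflects-true (≡ᵇ-reflects-≡ m m) refl)
freeSeries-*₁-oneMinusRange (suc e) m K e+m≡K = begin
  freeSeries m K *₁ (oneMinus (+ m) *₁ R)
    ≈⟨ freeSeries-*₁-oneMinus m K R ⟩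
  (const₁ (freeSeries m K 0) +₁ T) *₁ R
    ≈⟨ *₁-congʳ R (+₁-cong (≐-trans (const₁-cong initial) const₁-zero) (≐-refl {T})) ⟩
  (zero₁ +₁ T) *₁ R
    ≈⟨ ≐-trans (*₁-congʳ R (PS.+-identityˡ T)) (*₁-assoc (tpow₁ 1) (freeSeries (suc m) K) R) ⟩
  tpow₁ 1 *₁ (freeSeries (suc m) K *₁ R)
    ≈⟨ *₁-congˡ (tpow₁ 1) (freeSeries-*₁-oneMinusRange e (suc m) K (trans (ℕₚ.+-suc e m) e+m≡K)) ⟩
  tpow₁ 1 *₁ tpow₁ e
    ≈⟨ tpow₁-suc e ⟨
  tpow₁ (suc e) ∎
  where
  open ≐-Reasoning
  R = oneMinusRange (suc m) (suc e)
  T = tpow₁ 1 *₁ freeSeries (suc m) K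
  initial : freeSeries m K 0 ≡ + 0
  initial = cong (λ b → + (if b then 1 else 0)) (reflects-false (≡ᵇ-reflects-≡ m K) m≢K)
    where
    m≢K : m ≢ K
    m≢K m≡K = ℕₚ.m≢1+n+m m (trans m≡K (sym e+m≡K))

completionSeries-*₁-oneMinusRange :
  ∀ e m j c gs K → e + (m + (c + ∣ gs ∣)) ≡ K → j ≤ m →
  completionSeries m j c gs K *₁ oneMinusRange 0 (suc K)
    ≐ tpow₁ e *₁ (oneMinusRange 0 m *₁ (oneMinusRange j c *₁ fallingProduct gs))
completionSeries-*₁-oneMinusRange e m j (suc c) gs K eq j≤m = begin
  completionSeries m j (suc c) gs K *₁ D
    ≈⟨ *₁-congʳ D (completionSeries-suc m j c gs K) ⟩
  (d *₁ S₁ +₁ S₂) *₁ D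
    ≈⟨ ≐-trans (*₁-distribʳ (d *₁ S₁) S₂ D) (+₁-cong (*₁-assoc d S₁ D) newBlock) ⟩
  d *₁ (S₁ *₁ D) +₁ tpow₁ e *₁ (oneMinusRange 0 (suc m) *₁ X)
    ≈⟨ +₁-cong oldBlock (*₁-congˡ (tpow₁ e) (*₁-congʳ X (oneMinusRange-suc 0 m))) ⟩
  d *₁ (tpow₁ (suc e) *₁ (P *₁ X)) +₁ tpow₁ e *₁ ((P *₁ oneMinus (+ m)) *₁ X)
    ≈⟨ +₁-cong (*₁-congˡ d (*₁-congʳ (P *₁ X) (tpow₁-suc e))) ≐-refl ⟩
  d *₁ ((tpow₁ 1 *₁ tpow₁ e) *₁ (P *₁ X)) +₁ tpow₁ e *₁ ((P *₁ oneMinus (+ m)) *₁ X)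
    ≈⟨ *₁-regroup d (tpow₁ 1) (tpow₁ e) P X (oneMinus (+ m)) ⟩
  tpow₁ e *₁ (P *₁ ((d *₁ tpow₁ 1 +₁ oneMinus (+ m)) *₁ X))
    ≈⟨ *₁-congˡ (tpow₁ e) (*₁-congˡ P (*₁-congʳ X (oneMinus-split j≤m))) ⟩
  tpow₁ e *₁ (P *₁ (oneMinus (+ j) *₁ X))
    ≈⟨ *₁-congˡ (tpow₁ e) (*₁-congˡ P (*₁-assoc (oneMinus (+ j)) (oneMinusRange (suc j) c) G)) ⟨
  tpow₁ e *₁ (P *₁ (oneMinusRange j (suc c) *₁ G)) ∎
  where
  open ≐-Reasoning
  D = oneMinusRange 0 (suc K)
  d = const₁ (+ (m ∸ j))
  S₁ = completionSeries m (suc j) c gs K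
  S₂ = completionSeries (suc m) (suc j) c gs K
  P = oneMinusRange 0 m
  G = fallingProduct gs
  X = oneMinusRange (suc j) c *₁ G
  newBlock : S₂ *₁ D ≐ tpow₁ e *₁ (oneMinusRange 0 (suc m) *₁ X)
  newBlock = completionSeries-*₁-oneMinusRange e (suc m) (suc j) c gs K
               (trans (cong (_+_ e) (sym (ℕₚ.+-suc m (c + ∣ gs ∣)))) eq) (s≤s j≤m)
  oldBlock′ : j < m ⊎ j ≡ m → d *₁ (S₁ *₁ D) ≐ d *₁ (tpow₁ (suc e) *₁ (P *₁ X))
  oldBlock′ (inj₁ j<m) = *₁-congˡ d (completionSeries-*₁-oneMinusRange (suc e) m (suc j) c gs K
    (trans (sym (ℕₚ.+-suc e _)) (trans (cong (_+_ e) (sym (ℕₚ.+-suc m (c + ∣ gs ∣)))) eq)) j<m)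
  oldBlock′ (inj₂ refl) =
    ≐-trans (annihilate (S₁ *₁ D)) (≐-sym (annihilate (tpow₁ (suc e) *₁ (P *₁ X))))
    where
    annihilate : ∀ f → const₁ (+ (m ∸ m)) *₁ f ≐ zero₁
    annihilate f =
      ≐-trans (*₁-congʳ f (≐-trans (const₁-cong (cong +_ (ℕₚ.n∸n≡0 m))) const₁-zero)) (PS.zeroˡ f)
  oldBlock : d *₁ (S₁ *₁ D) ≐ d *₁ (tpow₁ (suc e) *₁ (P *₁ X))
  oldBlock = oldBlock′ (ℕₚ.m≤n⇒m<n∨m≡n j≤m)
completionSeries-*₁-oneMinusRange e m j zero (g ∷ gs) K eq j≤m = begin
  completionSeries m j 0 (g ∷ gs) K *₁ oneMinusRange 0 (suc K)
    ≈⟨ *₁-congʳ (oneMinusRange 0 (suc K)) (completionSeries-nextGroup m j g gs K) ⟩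
  completionSeries m 0 g gs K *₁ oneMinusRange 0 (suc K)
    ≈⟨ completionSeries-*₁-oneMinusRange e m 0 g gs K eq z≤n ⟩
  tpow₁ e *₁ (oneMinusRange 0 m *₁ G)
    ≈⟨ *₁-congˡ (tpow₁ e) (*₁-congˡ (oneMinusRange 0 m) (*₁-identityˡ G)) ⟨
  tpow₁ e *₁ (oneMinusRange 0 m *₁ (one₁ *₁ G)) ∎
  where
  open ≐-Reasoning
  G = fallingProduct (g ∷ gs)
completionSeries-*₁-oneMinusRange e m j zero [] K eq j≤m = begin
  completionSeries m j 0 [] K *₁ oneMinusRange 0 (suc K)
    ≈⟨ *₁-cong (completionSeries-free m j K) splitD ⟩
  freeSeries m K *₁ (P *₁ oneMinusRange m (suc e))
    ≈⟨ x∙yz≈y∙xz (freeSeries m K) P (oneMinusRange m (suc e)) ⟩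
  P *₁ (freeSeries m K *₁ oneMinusRange m (suc e))
    ≈⟨ *₁-congˡ P (freeSeries-*₁-oneMinusRange e m K e+m≡K) ⟩
  P *₁ tpow₁ e
    ≈⟨ *₁-comm P (tpow₁ e) ⟩
  tpow₁ e *₁ P
    ≈⟨ *₁-congˡ (tpow₁ e) (≐-trans (*₁-congˡ P (*₁-identityˡ one₁)) (*₁-identityʳ P)) ⟨
  tpow₁ e *₁ (P *₁ (one₁ *₁ one₁)) ∎
  where
  open ≐-Reasoning
  P = oneMinusRange 0 m
  e+m≡K : e + m ≡ K
  e+m≡K = trans (cong (_+_ e) (sym (ℕₚ.+-identityʳ m))) eq
  splitD : oneMinusRange 0 (suc K) ≐ P *₁ oneMinusRange m (suc e)
  splitD = ≐-trans (PS.reflexive (cong (oneMinusRange 0)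
                      (trans (cong suc (trans (sym e+m≡K) (ℕₚ.+-comm e m))) (sym (ℕₚ.+-suc m e)))))
                   (oneMinusRange-+ 0 m (suc e))

colGF-fallingProduct : ∀ r k →
  colGF r k ≐ tpow₁ k *₁ (fallingProduct r *₁ inv₁ (oneMinusRange 0 (suc (k + ∣ r ∣))))
colGF-fallingProduct r k .coeff n = byRange (k ≤ᵇ n) refl
  where
  K = k + ∣ r ∣
  D = oneMinusRange 0 (suc K)
  Y = fallingProduct r *₁ inv₁ D
  S = completionSeries 0 0 0 r K
  S≐tᵏY : S ≐ tpow₁ k *₁ Y
  S≐tᵏY = begin
    S                                   ≈⟨ *₁-identityʳ S ⟨
    S *₁ one₁                           ≈⟨ *₁-congˡ S (*₁-inv₁ D (oneMinusRange-0 0 (suc K))) ⟨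
    S *₁ (D *₁ inv₁ D)                  ≈⟨ *₁-assoc S D (inv₁ D) ⟨
    (S *₁ D) *₁ inv₁ D
      ≈⟨ *₁-congʳ (inv₁ D) (completionSeries-*₁-oneMinusRange k 0 0 0 r K refl z≤n) ⟩
    (tpow₁ k *₁ (one₁ *₁ (one₁ *₁ fallingProduct r))) *₁ inv₁ D
      ≈⟨ *₁-congʳ (inv₁ D) (*₁-congˡ (tpow₁ k)
                                     (≐-trans (*₁-identityˡ _) (*₁-identityˡ (fallingProduct r)))) ⟩
    (tpow₁ k *₁ fallingProduct r) *₁ inv₁ D
      ≈⟨ *₁-assoc (tpow₁ k) (fallingProduct r) (inv₁ D) ⟩
    tpow₁ k *₁ Y ∎
    where open ≐-Reasoning
  byRange : ∀ b → (k ≤ᵇ n) ≡ b → (if b then + StirR (n + ∣ r ∣) K r else + 0) ≡ (tpow₁ k *₁ Y) n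
  byRange true  _   = trans (cong +_ (trans (StirR-completions (n + ∣ r ∣) K r)
                                            (cong (λ N → completions N 0 0 0 r K) (ℕₚ.+-comm n ∣ r ∣))))
                            (coeff S≐tᵏY n)
  byRange false k>n =
    trans (cong (λ b → if b then Y (n ∸ k) else + 0) (sym k>n)) (sym (tpow₁-*₁ k Y n))

tpow₁-colGF : ∀ rs rp k →
  tpow₁ ∣ rs ∣ *₁ colGF (rs ++ rp ∷ []) k
    ≐ tpow₁ (k + ∣ rs ∣)
      *₁ (fallingProduct rs *₁ inv₁ (prod₁ (λ j → oneMinus (+ (rp + j))) (k + ∣ rs ∣)))
tpow₁-colGF rs rp k = begin
  tpow₁ s *₁ colGF (rs ++ rp ∷ []) k
    ≈⟨ *₁-congˡ (tpow₁ s) (colGF-fallingProduct (rs ++ rp ∷ []) k) ⟩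
  tpow₁ s *₁ (tpow₁ k *₁ Y)
    ≈⟨ x∙yz≈y∙xz (tpow₁ s) (tpow₁ k) Y ⟩
  tpow₁ k *₁ (tpow₁ s *₁ Y)
    ≈⟨ ≐-trans (*₁-congʳ Y (tpow₁-+ k s)) (*₁-assoc (tpow₁ k) (tpow₁ s) Y) ⟨
  tpow₁ (k + s) *₁ (fallingProduct (rs ++ rp ∷ []) *₁ inv₁ D)
    ≈⟨ *₁-congˡ (tpow₁ (k + s)) (*₁-congʳ (inv₁ D) (fallingProduct-∷ʳ rs rp)) ⟩
  tpow₁ (k + s) *₁ ((fallingProduct rs *₁ oneMinusRange 0 rp) *₁ inv₁ D)
    ≈⟨ *₁-congˡ (tpow₁ (k + s)) (*₁-assoc (fallingProduct rs) (oneMinusRange 0 rp) (inv₁ D)) ⟩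
  tpow₁ (k + s) *₁ (fallingProduct rs *₁ (oneMinusRange 0 rp *₁ inv₁ D))
    ≈⟨ *₁-congˡ (tpow₁ (k + s)) (*₁-congˡ (fallingProduct rs) cancel) ⟩
  tpow₁ (k + s) *₁ (fallingProduct rs *₁ inv₁ (prod₁ (λ j → oneMinus (+ (rp + j))) (k + s))) ∎
  where
  open ≐-Reasoning
  s = ∣ rs ∣
  D = oneMinusRange 0 (suc (k + ∣ rs ++ rp ∷ [] ∣))
  Y = fallingProduct (rs ++ rp ∷ []) *₁ inv₁ D
  R = oneMinusRange rp (suc (k + s))
  size : suc (k + ∣ rs ++ rp ∷ [] ∣) ≡ rp + suc (k + s)
  size = trans (cong (λ x → suc (k + x)) (sum-++ rs (rp ∷ []))) (arithmetic k s rp)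
    where
    arithmetic : ∀ k s rp → suc (k + (s + (rp + 0))) ≡ rp + suc (k + s)
    arithmetic = ℕ-solve-∀
  splitD : D ≐ oneMinusRange 0 rp *₁ R
  splitD = ≐-trans (PS.reflexive (cong (oneMinusRange 0) size)) (oneMinusRange-+ 0 rp (suc (k + s)))
  cancel : oneMinusRange 0 rp *₁ inv₁ D ≐ inv₁ (prod₁ (λ j → oneMinus (+ (rp + j))) (k + s))
  cancel = begin
    oneMinusRange 0 rp *₁ inv₁ D
      ≈⟨ *₁-congˡ (oneMinusRange 0 rp) (inv₁-cong (oneMinusRange-0 0 (suc (k + ∣ rs ++ rp ∷ [] ∣)))
                                                  splitD) ⟩
    oneMinusRange 0 rp *₁ inv₁ (oneMinusRange 0 rp *₁ R)
      ≈⟨ *₁-inv₁-*₁ (oneMinusRange 0 rp) R (oneMinusRange-0 0 rp) (oneMinusRange-0 rp (suc (k + s))) ⟩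
    inv₁ R
      ≈⟨ inv₁-cong (oneMinusRange-0 rp (suc (k + s))) (≐-sym (prod₁-oneMinus rp (k + s))) ⟩
    inv₁ (prod₁ (λ j → oneMinus (+ (rp + j))) (k + s)) ∎

-- Laurent series

infix 4 _≐₂_
_≐₂_ : PS2 → PS2 → Set
F ≐₂ G = ∀ a → F a ≐ G a

*₂-cong : ∀ {F F′ G G′} → F ≐₂ F′ → G ≐₂ G′ → F *₂ G ≐₂ F′ *₂ G′
*₂-cong F≐F′ G≐G′ a .coeff n = sumTo-cong a (λ i _ → sumTo-cong n (λ j _ →
  cong₂ ℤ._*_ (coeff (F≐F′ i) j) (coeff (G≐G′ (a ∸ i)) (n ∸ j))))

emb-cong : ∀ {f g} → f ≐ g → emb f ≐₂ emb g
emb-cong f≐g zero    = f≐g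
emb-cong f≐g (suc a) = ≐-refl

emb-*₂ : ∀ f G a → (emb f *₂ G) a ≐ f *₁ G a
emb-*₂ f G zero    .coeff n = refl
emb-*₂ f G (suc a) .coeff n =
  trans (sumTo-suc a _)
        (trans (cong (ℤ._+_ ((f *₁ G (suc a)) n)) (sumTo-zero a (λ i → sumTo-zero n (λ j → refl))))
               (ℤₚ.+-identityʳ _))

*₁-emb : ∀ f g a → f *₁ emb g a ≐ emb (f *₁ g) a
*₁-emb f g zero    = ≐-refl
*₁-emb f g (suc a) = PS.zeroʳ f

emb-*₂-emb : ∀ f g → emb f *₂ emb g ≐₂ emb (f *₁ g)
emb-*₂-emb f g a = ≐-trans (emb-*₂ f (emb g) a) (*₁-emb f g a)

shiftT-tpow₁ : ∀ s F a → shiftT s F a ≐ tpow₁ s *₁ F a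
shiftT-tpow₁ s F a .coeff n = sym (tpow₁-*₁ s (F a) n)

tInv-constL : ∀ c → ser (tInv -L constL c) ≐₂ emb (oneMinus c)
tInv-constL c zero    .coeff zero          = sym (oneMinus-0 c)
tInv-constL c zero    .coeff (suc zero)    = trans (ℤₚ.+-identityˡ _) (sym (coeff (tail₁-oneMinus c) 0))
tInv-constL c zero    .coeff (suc (suc n)) = sym (coeff (tail₁-oneMinus c) (suc n))
tInv-constL c (suc a) .coeff zero          = refl
tInv-constL c (suc a) .coeff (suc n)       = refl

fallingL-sh : ∀ r → sh (fallingL tInv r) ≡ r
fallingL-sh zero    = refl
fallingL-sh (suc r) = trans (cong (_+ 1) (fallingL-sh r)) (ℕₚ.+-comm r 1)

fallingL-ser : ∀ r → ser (fallingL tInv r) ≐₂ emb (oneMinusRange 0 r)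
fallingL-ser zero    = emb-cong ≐-refl
fallingL-ser (suc r) a = begin
  (ser (fallingL tInv r) *₂ ser (tInv -L constL (+ r))) a
    ≈⟨ *₂-cong (fallingL-ser r) (tInv-constL (+ r)) a ⟩
  (emb (oneMinusRange 0 r) *₂ emb (oneMinus (+ r))) a
    ≈⟨ emb-*₂-emb (oneMinusRange 0 r) (oneMinus (+ r)) a ⟩
  emb (oneMinusRange 0 r *₁ oneMinus (+ r)) a
    ≈⟨ emb-cong (oneMinusRange-suc 0 r) a ⟨
  emb (oneMinusRange 0 (suc r)) a ∎
  where open ≐-Reasoning

prefactor-sh : ∀ rs → sh (prefactor rs) ≡ ∣ rs ∣
prefactor-sh []       = refl
prefactor-sh (r ∷ rs) = cong₂ _+_ (fallingL-sh r) (prefactor-sh rs)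

prefactor-ser : ∀ rs → ser (prefactor rs) ≐₂ emb (fallingProduct rs)
prefactor-ser []       a = ≐-refl
prefactor-ser (r ∷ rs) a = ≐-trans (*₂-cong (fallingL-ser r) (prefactor-ser rs) a)
                                   (emb-*₂-emb (oneMinusRange 0 r) (fallingProduct rs) a)

prefactor-*₂ : ∀ rs G a → (ser (prefactor rs) *₂ G) a ≐ fallingProduct rs *₁ G a
prefactor-*₂ rs G a =
  ≐-trans (*₂-cong {G = G} (prefactor-ser rs) (λ _ → ≐-refl) a) (emb-*₂ (fallingProduct rs) G a)

colGF-≈L : ∀ rs rp k →
  ofPS (emb (colGF (rs ++ rp ∷ []) k))
    ≈L tPowL (k + ∣ rs ∣)
       *L (prefactor rs *L ofPS (emb (prod₁ (λ j → inv₁ (oneMinus (+ (rp + j)))) (k + ∣ rs ∣))))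
colGF-≈L rs rp k a n = begin
  shiftT (0 + (sh (prefactor rs) + 0)) (emb C) a n
    ≡⟨ cong (λ i → shiftT i (emb C) a n) (trans (ℕₚ.+-identityʳ _) (prefactor-sh rs)) ⟩
  shiftT s (emb C) a n
    ≡⟨ coeff (≐-trans (shiftT-tpow₁ s (emb C) a) (*₁-emb (tpow₁ s) C a)) n ⟩
  emb (tpow₁ s *₁ C) a n
    ≡⟨ coeff (emb-cong (tpow₁-colGF rs rp k) a) n ⟩
  emb (T *₁ (fallingProduct rs *₁ inv₁ (prod₁ F (k + s)))) a n
    ≡⟨ coeff (emb-cong (*₁-congˡ T (*₁-congˡ (fallingProduct rs) inverseOfProduct)) a) n ⟩
  emb (T *₁ (fallingProduct rs *₁ I)) a n
    ≡⟨ coeff unfold n ⟨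
  (emb T *₂ (ser (prefactor rs) *₂ emb I)) a n ∎
  where
  open ≡-Reasoning
  s = ∣ rs ∣
  C = colGF (rs ++ rp ∷ []) k
  T = tpow₁ (k + s)
  F = λ j → oneMinus (+ (rp + j))
  I = prod₁ (inv₁ ∘ F) (k + s)
  inverseOfProduct : inv₁ (prod₁ F (k + s)) ≐ I
  inverseOfProduct = inv₁-prod₁ F (λ j → oneMinus-0 (+ (rp + j))) (k + s)
  unfold : (emb T *₂ (ser (prefactor rs) *₂ emb I)) a ≐ emb (T *₁ (fallingProduct rs *₁ I)) a
  unfold = ≐-trans (emb-*₂ T (ser (prefactor rs) *₂ emb I) a)
                   (≐-trans (*₁-congˡ T (≐-trans (prefactor-*₂ rs (emb I) a)
                                                 (*₁-emb (fallingProduct rs) I a)))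
                            (*₁-emb T (fallingProduct rs *₁ I) a))

BGF-≈L : ∀ rs rp →
  ofPS (BGF (rs ++ rp ∷ []))
    ≈L prefactor rs
       *L ofPS (zSum (λ a → tpow₁ (a + ∣ rs ∣)
                            *₁ inv₁ (prod₁ (λ j → oneMinus (+ (rp + j))) (a + ∣ rs ∣))))
BGF-≈L rs rp a n = begin
  shiftT (sh (prefactor rs) + 0) (BGF r) a n
    ≡⟨ cong (λ i → shiftT i (BGF r) a n) (trans (ℕₚ.+-identityʳ _) (prefactor-sh rs)) ⟩
  shiftT s (BGF r) a n
    ≡⟨ coeff (shiftT-tpow₁ s (BGF r) a) n ⟩
  (tpow₁ s *₁ colGF r a) n
    ≡⟨ coeff (tpow₁-colGF rs rp a) n ⟩
  (tpow₁ (a + s) *₁ (fallingProduct rs *₁ inv₁ (prod₁ F (a + s)))) n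
    ≡⟨ coeff (x∙yz≈y∙xz (tpow₁ (a + s)) (fallingProduct rs) (inv₁ (prod₁ F (a + s)))) n ⟩
  (fallingProduct rs *₁ G a) n
    ≡⟨ coeff (prefactor-*₂ rs (zSum G) a) n ⟨
  (ser (prefactor rs) *₂ zSum G) a n ∎
  where
  open ≡-Reasoning
  r = rs ++ rp ∷ []
  s = ∣ rs ∣
  F = λ j → oneMinus (+ (rp + j))
  G = λ a → tpow₁ (a + s) *₁ inv₁ (prod₁ F (a + s))

theorem7 : (q : ℕ) (rs : Vec ℕ q) (rp : ℕ)
    → (∀ (i j : Fin (suc q)) → i Fin.≤ j → lookup (rs ∷ʳ rp) i ≤ lookup (rs ∷ʳ rp) j)
    → (∀ (k : ℕ) →
         ofPS (emb (colGF (toList (rs ∷ʳ rp)) k))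
           ≈L tPowL (k + ∣ toList rs ∣)
              *L (prefactor (toList rs)
              *L ofPS (emb (prod₁ (λ j → inv₁ (oneMinus (+ (rp + j)))) (k + ∣ toList rs ∣)))))
      × (ofPS (BGF (toList (rs ∷ʳ rp)))
           ≈L prefactor (toList rs)
              *L ofPS (zSum (λ a → tpow₁ (a + ∣ toList rs ∣)
                    *₁ inv₁ (prod₁ (λ j → oneMinus (+ (rp + j))) (a + ∣ toList rs ∣)))))
theorem7 q rs rp _ rewrite toList-∷ʳ rp rs = colGF-≈L (toList rs) rp , BGF-≈L (toList rs) rp
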